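{- Let $\Phi$ be a derivation in the CbV type system of $\Gamma\vdash^{(m,e)} t:M$. (1) If $t\to_{m,\mathrm{cbv}} t'$ then $m\geq 1$ and there is a derivation of $\Gamma\vdash^{(m-1,e)} t':M$. (2) If $t\to_{e,\mathrm{cbv}} t'$ then $e\geq 1$ and there is a derivation of $\Gamma\vdash^{(m,e-1)} t':M$.
   Context: Terms: $t,s ::= x \mid \lambda x.t \mid t\,s \mid t[x\leftarrow s]$, where $t[x\leftarrow s]$ (explicit substitution) binds $x$ in $t$; values $v ::= \lambda x.t$; usual free variables, terms up to $\alpha$-equivalence. Contexts: CbV (= weak) contexts $V ::= \langle\cdot\rangle \mid V t \mid V[x\leftarrow t] \mid t V \mid t[x\leftarrow V]$; substitution contexts $S ::= \langle\cdot\rangle \mid S[x\leftarrow t]$; $V\langle t\rangle$ plugging (may capture), $V\langle\langle t\rangle\rangle$ plugging where $V$ does not capture free variables of $t$. Root steps: $S\langle\lambda x.t\rangle s\mapsto_m S\langle t[x\leftarrow s]\rangle$ (variables bound by $S$ disjoint from $\mathrm{fv}(s)$); $V\langle\langle x\rangle\rangle[x\leftarrow S\langle v\rangle]\mapsto_e S\langle V\langle\langle v\rangle\rangle[x\leftarrow v]\rangle$ (variables bound by $S$ disjoint from $\mathrm{fv}(V\langle\langle x\rangle\rangle)$). $\to_{m,\mathrm{cbv}}$ (resp. $\to_{e,\mathrm{cbv}}$) relates $V\langle u'\rangle$ to $V\langle s'\rangle$ for any CbV context $V$ when $u'\mapsto_m s'$ (resp. $\mapsto_e$). CbV types: linear types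 $L ::= M\to N$; multi types $M,N ::= [L_i]_{i\in J}$ finite multisets, $\mathbf 0$ empty multiset, $\uplus$ union. Type contexts $\Gamma$ map variables to multi types, all but finitely many to $\mathbf 0$; $\uplus$ pointwise; $\Gamma,x:M$ means $\Gamma\uplus(x\mapsto M)$ with $\Gamma(x)=\mathbf 0$. Rules: (ax) $x:M\vdash^{(0,1)} x:M$ for any multi type $M$; (app) from $\Gamma\vdash^{(m,e)} t:[M\to N]$ and $\Pi\vdash^{(m',e')} s:M$ infer $\Gamma\uplus\Pi\vdash^{(m+m'+1,e+e')} t\,s:N$; (fun) from $\Gamma,x:N\vdash^{(m,e)} t:M$ infer $\Gamma\vdash^{(m,e)}\lambda x.t:N\to M$; (many) from $\Pi_i\vdash^{(m_i,e_i)}\lambda x.t:L_i$ for $i\in J$ ($J$ finite, possibly empty) infer $\biguplus_i\Pi_i\vdash^{(\sum m_i,\sum e_i)}\lambda x.t:[L_i]_{i\in J}$; (ES) from $\Gamma,x:N\vdash^{(m,e)} t:M$ and $\Pi\vdash^{(m',e')} s:N$ infer $\Gamma\uplus\Pi\vdash^{(m+m',e+e')} t[x\leftarrow s]:M$. -}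

module Defs where

open import Data.Nat using (ℕ; zero; suc; _+_)
open import Data.Fin using (Fin; zero; suc)
open import Data.List using (List; []; _∷_; _++_)
open import Data.Vec using (Vec; []; _∷_; zipWith; replicate)
open import Data.List.Relation.Binary.Permutation.Homogeneous using (Permutation)
import Data.Vec.Relation.Binary.Pointwise.Inductive as VecPW

-- Terms (well-scoped de Bruijn: Tm n = terms with free vars among n)

data Tm (n : ℕ) : Set where
  var : Fin n → Tm n
  lam : Tm (suc n) → Tm n
  app : Tm n → Tm n → Tm n
  es  : Tm (suc n) → Tm n → Tm n          -- t[x←s], x bound in t (index 0)

Ren : ℕ → ℕ → Set
Ren n m = Fin n → Fin m

lift : ∀ {n m} → Ren n m → Ren (suc n) (suc m)
lift ρ zero    = zero
lift ρ (suc i) = suc (ρ i)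

rename : ∀ {n m} → Ren n m → Tm n → Tm m
rename ρ (var i)   = var (ρ i)
rename ρ (lam t)   = lam (rename (lift ρ) t)
rename ρ (app t s) = app (rename ρ t) (rename ρ s)
rename ρ (es t s)  = es (rename (lift ρ) t) (rename ρ s)

-- b ⊕ n : scope n extended by b binders (recursion on b, so that
-- suc b ⊕ n reduces to b ⊕ suc n)
_⊕_ : ℕ → ℕ → ℕ
zero  ⊕ n = n
suc b ⊕ n = b ⊕ suc n

wkN : ∀ b {n} → Ren n (b ⊕ n)
wkN zero    i = i
wkN (suc b) i = wkN b (suc i)

liftN : ∀ b {n m} → Ren n m → Ren (b ⊕ n) (b ⊕ m)
liftN zero    ρ = ρ
liftN (suc b) ρ = liftN b (lift ρ)

-- CbV (weak) contexts and substitution contexts.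
-- WCtx b n : a context with outer scope n whose hole is under b binders.

data WCtx : ℕ → ℕ → Set where
  hole : ∀ {n} → WCtx zero n
  appL : ∀ {b n} → WCtx b n → Tm n → WCtx b n
  appR : ∀ {b n} → Tm n → WCtx b n → WCtx b n
  esL  : ∀ {b n} → WCtx b (suc n) → Tm n → WCtx (suc b) n
  esR  : ∀ {b n} → Tm (suc n) → WCtx b n → WCtx b n

-- plugging (capture allowed: the plugged term lives in the hole's scope)
plugW : ∀ {b n} → WCtx b n → Tm (b ⊕ n) → Tm n
plugW hole       u = u
plugW (appL V t) u = app (plugW V u) t
plugW (appR t V) u = app t (plugW V u)
plugW (esL V t)  u = es (plugW V u) t
plugW (esR t V)  u = es t (plugW V u)

renW : ∀ {b n m} → Ren n m → WCtx b n → WCtx b m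
renW ρ hole       = hole
renW ρ (appL V t) = appL (renW ρ V) (rename ρ t)
renW ρ (appR t V) = appR (rename ρ t) (renW ρ V)
renW ρ (esL V t)  = esL (renW (lift ρ) V) (rename ρ t)
renW ρ (esR t V)  = esR (rename (lift ρ) t) (renW ρ V)

data SCtx : ℕ → ℕ → Set where
  hole : ∀ {n} → SCtx zero n
  sub  : ∀ {b n} → SCtx b (suc n) → Tm n → SCtx (suc b) n

plugS : ∀ {b n} → SCtx b n → Tm (b ⊕ n) → Tm n
plugS hole      u = u
plugS (sub S t) u = es (plugS S u) t

-- Root rules.  Non-capture side conditions (V⟨⟨·⟩⟩, disjointness from
-- the variables bound by S) are realised by de Bruijn weakening.

data _↦m_ {n : ℕ} : Tm n → Tm n → Set where
  -- S⟨λx.t⟩ s ↦m S⟨t[x←s]⟩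
  rootM : ∀ {b} (S : SCtx b n) (t : Tm (suc (b ⊕ n))) (s : Tm n) →
          app (plugS S (lam t)) s ↦m plugS S (es t (rename (wkN b) s))

data _↦e_ {n : ℕ} : Tm n → Tm n → Set where
  -- V⟨⟨x⟩⟩[x←S⟨v⟩] ↦e S⟨V⟨⟨v⟩⟩[x←v]⟩ , v = λy.u
  rootE : ∀ {b c} (V : WCtx b (suc n)) (S : SCtx c n) (u : Tm (suc (c ⊕ n))) →
          es (plugW V (var (wkN b zero))) (plugS S (lam u))
          ↦e plugS S (es (plugW (renW (lift (wkN c)) V) (rename (wkN (suc b)) (lam u)))
                         (lam u))

data _→m_ {n : ℕ} : Tm n → Tm n → Set where
  stepM : ∀ {b} (V : WCtx b n) {u s : Tm (b ⊕ n)} → u ↦m s → plugW V u →m plugW V s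

data _→e_ {n : ℕ} : Tm n → Tm n → Set where
  stepE : ∀ {b} (V : WCtx b n) {u s : Tm (b ⊕ n)} → u ↦e s → plugW V u →e plugW V s

-- CbV types.  Multi types are finite multisets, represented as lists
-- taken up to _≈M_ = permutation with (recursively) equivalent elements.

data LTy : Set where
  _⇒_ : List LTy → List LTy → LTy

MTy : Set
MTy = List LTy

data _≈L_ : LTy → LTy → Set where
  ⇒-cong : ∀ {M M′ N N′} → Permutation _≈L_ M M′ → Permutation _≈L_ N N′ →
           (M ⇒ N) ≈L (M′ ⇒ N′)

_≈M_ : MTy → MTy → Set
_≈M_ = Permutation _≈L_

data Ty : Set where
  lin : LTy → Ty
  mul : MTy → Ty

data _≈T_ : Ty → Ty → Set where
  lin-cong : ∀ {L L′} → L ≈L L′ → lin L ≈T lin L′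
  mul-cong : ∀ {M M′} → M ≈M M′ → mul M ≈T mul M′

Ctx : ℕ → Set
Ctx n = Vec MTy n

_≈C_ : ∀ {n} → Ctx n → Ctx n → Set
_≈C_ = VecPW.Pointwise _≈M_

𝟘 : ∀ {n} → Ctx n
𝟘 {n} = replicate n []

_⊎_ : ∀ {n} → Ctx n → Ctx n → Ctx n
_⊎_ = zipWith _++_

single : ∀ {n} → Fin n → MTy → Ctx n
single zero    M = M ∷ 𝟘
single (suc x) M = [] ∷ single x M

infix 4 _⊢_∶_⟨_,_⟩

-- Γ ⊢^(m,e) t : A.  The rule conv makes the judgment respect multiset
-- equality (Agda has no quotients); it does not change the indices.
data _⊢_∶_⟨_,_⟩ {n : ℕ} : Ctx n → Tm n → Ty → ℕ → ℕ → Set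
data Many {n : ℕ} : Ctx n → Tm (suc n) → List LTy → ℕ → ℕ → Set

data _⊢_∶_⟨_,_⟩ {n} where
  ax   : ∀ (x : Fin n) (M : MTy) → single x M ⊢ var x ∶ mul M ⟨ 0 , 1 ⟩
  app  : ∀ {Γ Π t s M N m e m′ e′} →
         Γ ⊢ t ∶ mul ((M ⇒ N) ∷ []) ⟨ m , e ⟩ → Π ⊢ s ∶ mul M ⟨ m′ , e′ ⟩ →
         Γ ⊎ Π ⊢ app t s ∶ mul N ⟨ m + m′ + 1 , e + e′ ⟩
  fun  : ∀ {Γ t N M m e} →
         (N ∷ Γ) ⊢ t ∶ mul M ⟨ m , e ⟩ → Γ ⊢ lam t ∶ lin (N ⇒ M) ⟨ m , e ⟩
  many : ∀ {Γ t Ls m e} → Many Γ t Ls m e → Γ ⊢ lam t ∶ mul Ls ⟨ m , e ⟩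
  ES   : ∀ {Γ Π t s N M m e m′ e′} →
         (N ∷ Γ) ⊢ t ∶ mul M ⟨ m , e ⟩ → Π ⊢ s ∶ mul N ⟨ m′ , e′ ⟩ →
         Γ ⊎ Π ⊢ es t s ∶ mul M ⟨ m + m′ , e + e′ ⟩
  conv : ∀ {Γ Γ′ t A A′ m e} → Γ ⊢ t ∶ A ⟨ m , e ⟩ → Γ ≈C Γ′ → A ≈T A′ →
         Γ′ ⊢ t ∶ A′ ⟨ m , e ⟩

-- the premises Π_i ⊢ λx.t : L_i (i ∈ J) of rule many, J a finite list
data Many {n} where
  []  : ∀ {t} → Many 𝟘 t [] 0 0
  _∷_ : ∀ {Γ Π t L Ls m e m′ e′} →
        Γ ⊢ lam t ∶ lin L ⟨ m , e ⟩ → Many Π t Ls m′ e′ →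
        Many (Γ ⊎ Π) t (L ∷ Ls) (m + m′) (e + e′)

module Submission where

-- Subject reduction with exact counting for the CbV multi type system:
-- a multiplicative step consumes exactly one application rule (m drops
-- by one), an exponential step exactly one axiom (e drops by one).

open import Defs
open import Data.Nat using (ℕ; zero; suc; _+_; _≤_; _∸_; s≤s; z≤n)
open import Data.Nat.Properties using (+-suc; +-identityʳ; +-comm; +-assoc)
open import Data.Nat.Tactic.RingSolver using (solve-∀)
open import Data.Fin using (Fin; zero; suc)
open import Data.List using ([]; _∷_; _++_)
open import Data.Vec using (Vec; []; _∷_)
open import Data.Product using (_×_; _,_; Σ)
open import Relation.Binary.PropositionalEquality
  using (_≡_; refl; sym; trans; cong; cong₂; subst; subst₂)
open import Relation.Binary.Bundles using (Setoid)
open import Algebra.Bundles using (CommutativeMonoid)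
import Algebra.Properties.CommutativeSemigroup as CommSemigroupProps
import Data.List.Relation.Binary.Permutation.Homogeneous as Perm
import Data.List.Relation.Binary.Pointwise.Base as ListPW
import Data.List.Relation.Binary.Permutation.Setoid.Properties as PermProps
import Data.Vec.Relation.Binary.Pointwise.Inductive as VecPW
open VecPW using ([]; _∷_)

mutual
  ≈L-refl : ∀ L → L ≈L L
  ≈L-refl (M ⇒ N) = ⇒-cong (≈M-refl M) (≈M-refl N)

  ≈M-refl : ∀ M → M ≈M M
  ≈M-refl M = Perm.refl (pointwise-refl M)

  pointwise-refl : ∀ M → ListPW.Pointwise _≈L_ M M
  pointwise-refl []      = ListPW.[]
  pointwise-refl (L ∷ M) = ≈L-refl L ListPW.∷ pointwise-refl M

mutual
  ≈L-sym : ∀ {L L′} → L ≈L L′ → L′ ≈L L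
  ≈L-sym (⇒-cong p q) = ⇒-cong (≈M-sym p) (≈M-sym q)

  ≈M-sym : ∀ {M M′} → M ≈M M′ → M′ ≈M M
  ≈M-sym (Perm.refl p)     = Perm.refl (pointwise-sym p)
  ≈M-sym (Perm.prep p q)   = Perm.prep (≈L-sym p) (≈M-sym q)
  ≈M-sym (Perm.swap p q r) = Perm.swap (≈L-sym q) (≈L-sym p) (≈M-sym r)
  ≈M-sym (Perm.trans p q)  = Perm.trans (≈M-sym q) (≈M-sym p)

  pointwise-sym : ∀ {M M′} → ListPW.Pointwise _≈L_ M M′ → ListPW.Pointwise _≈L_ M′ M
  pointwise-sym ListPW.[]       = ListPW.[]
  pointwise-sym (p ListPW.∷ ps) = ≈L-sym p ListPW.∷ pointwise-sym ps

≈L-trans : ∀ {L L′ L″} → L ≈L L′ → L′ ≈L L″ → L ≈L L″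
≈L-trans (⇒-cong p q) (⇒-cong p′ q′) = ⇒-cong (Perm.trans p p′) (Perm.trans q q′)

linSetoid : Setoid _ _
linSetoid = record
  { Carrier       = LTy
  ; _≈_           = _≈L_
  ; isEquivalence = record { refl = ≈L-refl _ ; sym = ≈L-sym ; trans = ≈L-trans }
  }

module MP = PermProps linSetoid

multiMonoid : CommutativeMonoid _ _
multiMonoid = MP.++-commutativeMonoid

ctxMonoid : ℕ → CommutativeMonoid _ _
ctxMonoid n = record
  { Carrier             = Ctx n
  ; _≈_                 = _≈C_
  ; _∙_                 = _⊎_
  ; ε                   = 𝟘
  ; isCommutativeMonoid = record
    { isMonoid = record
      { isSemigroup = record
        { isMagma = record
          { isEquivalence = record
            { refl  = VecPW.refl M.refl
            ; sym   = VecPW.sym M.sym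
            ; trans = VecPW.trans M.trans
            }
          ; ∙-cong = VecPW.zipWith-cong M.∙-cong
          }
        ; assoc = VecPW.zipWith-assoc M.assoc
        }
      ; identity = VecPW.zipWith-identityˡ M.identityˡ , VecPW.zipWith-identityʳ M.identityʳ
      }
    ; comm = VecPW.zipWith-comm M.comm
    }
  }
  where module M = CommutativeMonoid multiMonoid

module _ {n : ℕ} where
  open CommutativeMonoid (ctxMonoid n) public
    using ()
    renaming ( refl to ≈C-refl; sym to ≈C-sym; trans to ≈C-trans
             ; reflexive to ≈C-reflexive
             ; ∙-cong to ⊎-cong; assoc to ⊎-assoc; comm to ⊎-comm
             ; identityˡ to 𝟘⊎; identityʳ to ⊎𝟘 )
  open CommSemigroupProps (CommutativeMonoid.commutativeSemigroup (ctxMonoid n)) public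
    using (x∙yz≈y∙xz; xy∙z≈xz∙y)

≈T-refl : ∀ A → A ≈T A
≈T-refl (lin L) = lin-cong (≈L-refl L)
≈T-refl (mul M) = mul-cong (≈M-refl M)

≈T-sym : ∀ {A B} → A ≈T B → B ≈T A
≈T-sym (lin-cong p) = lin-cong (≈L-sym p)
≈T-sym (mul-cong p) = mul-cong (≈M-sym p)

≈T-trans : ∀ {A B C} → A ≈T B → B ≈T C → A ≈T C
≈T-trans (lin-cong p) (lin-cong q) = lin-cong (≈L-trans p q)
≈T-trans (mul-cong p) (mul-cong q) = mul-cong (Perm.trans p q)

⊢-≡ : ∀ {n} {Γ Γ′ : Ctx n} {t A m e} → Γ ≡ Γ′ → Γ ⊢ t ∶ A ⟨ m , e ⟩ → Γ′ ⊢ t ∶ A ⟨ m , e ⟩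
⊢-≡ refl d = d

⊢-idx : ∀ {n} {Γ : Ctx n} {t A m e m′ e′} → m ≡ m′ → e ≡ e′ →
        Γ ⊢ t ∶ A ⟨ m , e ⟩ → Γ ⊢ t ∶ A ⟨ m′ , e′ ⟩
⊢-idx refl refl d = d

⊢-≈C : ∀ {n} {Γ Γ′ : Ctx n} {t A m e} → Γ ≈C Γ′ → Γ ⊢ t ∶ A ⟨ m , e ⟩ → Γ′ ⊢ t ∶ A ⟨ m , e ⟩
⊢-≈C {A = A} p d = conv d p (≈T-refl A)

-- Context for a term under b binders: Ω types the b bound variables
-- (innermost first), Γ the outer scope.
_++ᶜ_ : ∀ {b n} → Vec MTy b → Ctx n → Ctx (b ⊕ n)
[]      ++ᶜ Γ = Γ
(M ∷ Ω) ++ᶜ Γ = Ω ++ᶜ (M ∷ Γ)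

ε : ∀ b → Vec MTy b
ε b = 𝟘

++ᶜ-⊎ : ∀ {b n} (Ω Ω′ : Vec MTy b) (Γ Γ′ : Ctx n) →
        ((Ω ++ᶜ Γ) ⊎ (Ω′ ++ᶜ Γ′)) ≡ ((Ω ⊎ Ω′) ++ᶜ (Γ ⊎ Γ′))
++ᶜ-⊎ []      []       Γ Γ′ = refl
++ᶜ-⊎ (M ∷ Ω) (M′ ∷ Ω′) Γ Γ′ = ++ᶜ-⊎ Ω Ω′ (M ∷ Γ) (M′ ∷ Γ′)

++ᶜ-cong : ∀ {b n} {Ω Ω′ : Vec MTy b} {Γ Γ′ : Ctx n} →
           Ω ≈C Ω′ → Γ ≈C Γ′ → (Ω ++ᶜ Γ) ≈C (Ω′ ++ᶜ Γ′)
++ᶜ-cong []       q = q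
++ᶜ-cong (p ∷ ps) q = ++ᶜ-cong ps (p ∷ q)

ε-++ᶜ-⊎ : ∀ {b n} (Ω : Vec MTy b) (Γ Δ : Ctx n) →
          ((ε b ++ᶜ Γ) ⊎ (Ω ++ᶜ Δ)) ≈C (Ω ++ᶜ (Γ ⊎ Δ))
ε-++ᶜ-⊎ {b} Ω Γ Δ =
  ≈C-trans (≈C-reflexive (++ᶜ-⊎ (ε b) Ω Γ Δ)) (++ᶜ-cong (𝟘⊎ Ω) ≈C-refl)

++ᶜ-cancel : ∀ {b n} (Ω Ω′ : Vec MTy b) {Γ Γ′ : Ctx n} →
             (Ω ++ᶜ Γ) ≈C (Ω′ ++ᶜ Γ′) → Ω ≈C Ω′ × Γ ≈C Γ′
++ᶜ-cancel []      []       p = [] , p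
++ᶜ-cancel (M ∷ Ω) (M′ ∷ Ω′) p with ++ᶜ-cancel Ω Ω′ p
... | q , (r ∷ s) = (r ∷ q) , s

single-wkN : ∀ b {n} (x : Fin n) M → single (wkN b x) M ≡ (ε b ++ᶜ single x M)
single-wkN zero    x M = refl
single-wkN (suc b) x M = single-wkN b (suc x) M

-- Thinnings: order-preserving embeddings of scopes.  Their action on
-- variables lifts under a binder by definition, which makes typing
-- stability under thinnings a plain structural induction.
data Thin : ℕ → ℕ → Set where
  done : Thin 0 0
  keep : ∀ {n m} → Thin n m → Thin (suc n) (suc m)
  skip : ∀ {n m} → Thin n m → Thin n (suc m)

⟦_⟧ : ∀ {n m} → Thin n m → Ren n m
⟦ done   ⟧ ()
⟦ keep θ ⟧ = lift ⟦ θ ⟧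
⟦ skip θ ⟧ i = suc (⟦ θ ⟧ i)

thinC : ∀ {n m} → Thin n m → Ctx n → Ctx m
thinC done     []      = []
thinC (keep θ) (M ∷ Γ) = M ∷ thinC θ Γ
thinC (skip θ) Γ       = [] ∷ thinC θ Γ

thinC-𝟘 : ∀ {n m} (θ : Thin n m) → thinC θ 𝟘 ≡ 𝟘
thinC-𝟘 done     = refl
thinC-𝟘 (keep θ) = cong ([] ∷_) (thinC-𝟘 θ)
thinC-𝟘 (skip θ) = cong ([] ∷_) (thinC-𝟘 θ)

thinC-⊎ : ∀ {n m} (θ : Thin n m) (Γ Δ : Ctx n) → thinC θ (Γ ⊎ Δ) ≡ (thinC θ Γ ⊎ thinC θ Δ)
thinC-⊎ done     []      []      = refl
thinC-⊎ (keep θ) (M ∷ Γ) (N ∷ Δ) = cong ((M ++ N) ∷_) (thinC-⊎ θ Γ Δ)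
thinC-⊎ (skip θ) Γ       Δ       = cong ([] ∷_) (thinC-⊎ θ Γ Δ)

thinC-single : ∀ {n m} (θ : Thin n m) (x : Fin n) M → thinC θ (single x M) ≡ single (⟦ θ ⟧ x) M
thinC-single (keep θ) zero    M = cong (M ∷_) (thinC-𝟘 θ)
thinC-single (keep θ) (suc x) M = cong ([] ∷_) (thinC-single θ x M)
thinC-single (skip θ) x       M = cong ([] ∷_) (thinC-single θ x M)

thinC-≈ : ∀ {n m} (θ : Thin n m) {Γ Δ : Ctx n} → Γ ≈C Δ → thinC θ Γ ≈C thinC θ Δ
thinC-≈ done     []       = []
thinC-≈ (keep θ) (p ∷ ps) = p ∷ thinC-≈ θ ps
thinC-≈ (skip θ) ps       = ≈M-refl [] ∷ thinC-≈ θ ps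

mutual
  thin⊢ : ∀ {n m} (θ : Thin n m) {Γ t A k l} →
          Γ ⊢ t ∶ A ⟨ k , l ⟩ → thinC θ Γ ⊢ rename ⟦ θ ⟧ t ∶ A ⟨ k , l ⟩
  thin⊢ θ (ax x M)              = ⊢-≡ (sym (thinC-single θ x M)) (ax (⟦ θ ⟧ x) M)
  thin⊢ θ (app {Γ = Γ} {Π} d d′) = ⊢-≡ (sym (thinC-⊎ θ Γ Π)) (app (thin⊢ θ d) (thin⊢ θ d′))
  thin⊢ θ (fun d)               = fun (thin⊢ (keep θ) d)
  thin⊢ θ (many ds)             = many (thinMany θ ds)
  thin⊢ θ (ES {Γ = Γ} {Π} d d′)  = ⊢-≡ (sym (thinC-⊎ θ Γ Π)) (ES (thin⊢ (keep θ) d) (thin⊢ θ d′))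
  thin⊢ θ (conv d p q)          = conv (thin⊢ θ d) (thinC-≈ θ p) q

  thinMany : ∀ {n m} (θ : Thin n m) {Γ t Ls k l} →
             Many Γ t Ls k l → Many (thinC θ Γ) (rename (lift ⟦ θ ⟧) t) Ls k l
  thinMany θ {t = t} []            =
    subst (λ Γ → Many Γ (rename (lift ⟦ θ ⟧) t) [] 0 0) (sym (thinC-𝟘 θ)) []
  thinMany θ (_∷_ {Γ = Γ} {Π} d ds) =
    subst (λ Δ → Many Δ _ _ _ _) (sym (thinC-⊎ θ Γ Π)) (thin⊢ θ d ∷ thinMany θ ds)

-- Renaming respects pointwise equality of renamings (no function
-- extensionality is available).
lift-cong : ∀ {n m} {ρ σ : Ren n m} → (∀ i → ρ i ≡ σ i) → ∀ i → lift ρ i ≡ lift σ i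
lift-cong eq zero    = refl
lift-cong eq (suc i) = cong suc (eq i)

rename-cong : ∀ {n m} {ρ σ : Ren n m} → (∀ i → ρ i ≡ σ i) → ∀ t → rename ρ t ≡ rename σ t
rename-cong eq (var i)   = cong var (eq i)
rename-cong eq (lam t)   = cong lam (rename-cong (lift-cong eq) t)
rename-cong eq (app t s) = cong₂ app (rename-cong eq t) (rename-cong eq s)
rename-cong eq (es t s)  = cong₂ es (rename-cong (lift-cong eq) t) (rename-cong eq s)

idT : ∀ {n} → Thin n n
idT {zero}  = done
idT {suc n} = keep idT

idT-⟦⟧ : ∀ {n} (i : Fin n) → ⟦ idT ⟧ i ≡ i
idT-⟦⟧ zero    = refl
idT-⟦⟧ (suc i) = cong suc (idT-⟦⟧ i)

idT-C : ∀ {n} (Γ : Ctx n) → thinC idT Γ ≡ Γ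
idT-C []      = refl
idT-C (M ∷ Γ) = cong (M ∷_) (idT-C Γ)

tl : ∀ {n m} → Thin (suc n) m → Thin n m
tl (keep θ) = skip θ
tl (skip θ) = skip (tl θ)

tl-⟦⟧ : ∀ {n m} (θ : Thin (suc n) m) (i : Fin n) → ⟦ tl θ ⟧ i ≡ ⟦ θ ⟧ (suc i)
tl-⟦⟧ (keep θ) i = refl
tl-⟦⟧ (skip θ) i = cong suc (tl-⟦⟧ θ i)

tl-C : ∀ {n m} (θ : Thin (suc n) m) (Γ : Ctx n) → thinC (tl θ) Γ ≡ thinC θ ([] ∷ Γ)
tl-C (keep θ) Γ = refl
tl-C (skip θ) Γ = cong ([] ∷_) (tl-C θ Γ)

wkθ : ∀ b {n} → Thin n (b ⊕ n)
wkθ zero    = idT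
wkθ (suc b) = tl (wkθ b)

wkθ-⟦⟧ : ∀ b {n} (i : Fin n) → ⟦ wkθ b ⟧ i ≡ wkN b i
wkθ-⟦⟧ zero    i = idT-⟦⟧ i
wkθ-⟦⟧ (suc b) i = trans (tl-⟦⟧ (wkθ b) i) (wkθ-⟦⟧ b (suc i))

wkθ-C : ∀ b {n} (Γ : Ctx n) → thinC (wkθ b) Γ ≡ (ε b ++ᶜ Γ)
wkθ-C zero    Γ = idT-C Γ
wkθ-C (suc b) Γ = trans (tl-C (wkθ b) Γ) (wkθ-C b ([] ∷ Γ))

wk⊢ : ∀ b {n} {Γ : Ctx n} {t A k l} →
      Γ ⊢ t ∶ A ⟨ k , l ⟩ → (ε b ++ᶜ Γ) ⊢ rename (wkN b) t ∶ A ⟨ k , l ⟩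
wk⊢ b {Γ = Γ} {t} d =
  subst (λ u → _ ⊢ u ∶ _ ⟨ _ , _ ⟩) (rename-cong (wkθ-⟦⟧ b) t)
        (⊢-≡ (wkθ-C b Γ) (thin⊢ (wkθ b) d))

wkUnder⊢ : ∀ c {n} {N} {Γ : Ctx n} {t A k l} → (N ∷ Γ) ⊢ t ∶ A ⟨ k , l ⟩ →
           (N ∷ (ε c ++ᶜ Γ)) ⊢ rename (lift (wkN c)) t ∶ A ⟨ k , l ⟩
wkUnder⊢ c {N = N} {Γ} {t} d =
  subst (λ u → _ ⊢ u ∶ _ ⟨ _ , _ ⟩) (rename-cong (lift-cong (wkθ-⟦⟧ c)) t)
        (⊢-≡ (cong (N ∷_) (wkθ-C c Γ)) (thin⊢ (keep (wkθ c)) d))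

rename-plug : ∀ {b n m} (ρ : Ren n m) (V : WCtx b n) (t : Tm (b ⊕ n)) →
              rename ρ (plugW V t) ≡ plugW (renW ρ V) (rename (liftN b ρ) t)
rename-plug ρ hole       t = refl
rename-plug ρ (appL V s) t = cong (λ u → app u (rename ρ s)) (rename-plug ρ V t)
rename-plug ρ (appR s V) t = cong (app (rename ρ s)) (rename-plug ρ V t)
rename-plug ρ (esL V s)  t = cong (λ u → es u (rename ρ s)) (rename-plug (lift ρ) V t)
rename-plug ρ (esR s V)  t = cong (es (rename (lift ρ) s)) (rename-plug ρ V t)

liftN-wkN : ∀ b {n m} (ρ : Ren n m) (i : Fin n) → liftN b ρ (wkN b i) ≡ wkN b (ρ i)
liftN-wkN zero    ρ i = refl
liftN-wkN (suc b) ρ i = liftN-wkN b (lift ρ) (suc i)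

rename-plug-var : ∀ {b n m} (ρ : Ren n m) (V : WCtx b n) (i : Fin n) →
                  rename ρ (plugW V (var (wkN b i))) ≡ plugW (renW ρ V) (var (wkN b (ρ i)))
rename-plug-var {b} ρ V i =
  trans (rename-plug ρ V _) (cong (λ j → plugW (renW ρ V) (var j)) (liftN-wkN b ρ i))

-- The hole receives the
-- part Ω ++ᶜ Δ of the context (Ω for the binders of V) and indices
-- (m₀, e₀); the rest of V contributes Γᵣ and (k, l).
record Decomposition {b n} (V : WCtx b n) (t : Tm (b ⊕ n)) (Γ : Ctx n) (A : Ty) (m e : ℕ) : Set where
  constructor decomposition
  field
    Ω        : Vec MTy b
    Δ Γᵣ     : Ctx n
    B        : Ty
    m₀ e₀ k l : ℕ
    hole⊢    : (Ω ++ᶜ Δ) ⊢ t ∶ B ⟨ m₀ , e₀ ⟩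
    m-split  : m ≡ k + m₀
    e-split  : e ≡ l + e₀
    Γ-split  : Γ ≈C (Γᵣ ⊎ Δ)
    rebuild  : ∀ {Δ′ t′ m′ e′} → (Ω ++ᶜ Δ′) ⊢ t′ ∶ B ⟨ m′ , e′ ⟩ →
               (Γᵣ ⊎ Δ′) ⊢ plugW V t′ ∶ A ⟨ k + m′ , l + e′ ⟩

private
  left-app : ∀ a b c → a + b + c + 1 ≡ a + c + 1 + b
  left-app = solve-∀

  left-es : ∀ a b c → a + b + c ≡ a + c + b
  left-es = solve-∀

  right-app : ∀ a b c → a + (b + c) + 1 ≡ a + b + 1 + c
  right-app = solve-∀

  right-es : ∀ a b c → a + (b + c) ≡ a + b + c
  right-es = solve-∀

decompose : ∀ {b n} (V : WCtx b n) {t Γ A m e} → Γ ⊢ plugW V t ∶ A ⟨ m , e ⟩ → Decomposition V t Γ A m e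
decompose hole {Γ = Γ} {A} {m} {e} d =
  decomposition [] Γ 𝟘 A m e 0 0 d refl refl (≈C-sym (𝟘⊎ Γ)) (⊢-≈C (≈C-sym (𝟘⊎ _)))
decompose V (conv d p q) with decompose V d
... | decomposition Ω Δ Γᵣ B m₀ e₀ k l d₀ m≡ e≡ Γ≈ rb =
  decomposition Ω Δ Γᵣ B m₀ e₀ k l d₀ m≡ e≡ (≈C-trans (≈C-sym p) Γ≈) (λ d′ → conv (rb d′) ≈C-refl q)
decompose (appL V s) (app {Π = Π} {m′ = m₂} {e′ = e₂} d₁ d₂) with decompose V d₁
... | decomposition Ω Δ Γᵣ B m₀ e₀ k l d₀ refl refl Γ≈ rb =
  decomposition Ω Δ (Γᵣ ⊎ Π) B m₀ e₀ (k + m₂ + 1) (l + e₂) d₀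
    (left-app k m₀ m₂) (left-es l e₀ e₂)
    (≈C-trans (⊎-cong Γ≈ ≈C-refl) (xy∙z≈xz∙y Γᵣ Δ Π))
    (λ {Δ′} {_} {m′} {e′} d′ → ⊢-idx (left-app k m′ m₂) (left-es l e′ e₂)
       (⊢-≈C (xy∙z≈xz∙y Γᵣ Δ′ Π) (app (rb d′) d₂)))
decompose (appR s V) (app {Γ = Γ₁} {m = m₁} {e = e₁} d₁ d₂) with decompose V d₂
... | decomposition Ω Δ Γᵣ B m₀ e₀ k l d₀ refl refl Γ≈ rb =
  decomposition Ω Δ (Γ₁ ⊎ Γᵣ) B m₀ e₀ (m₁ + k + 1) (e₁ + l) d₀
    (right-app m₁ k m₀) (right-es e₁ l e₀)
    (≈C-trans (⊎-cong ≈C-refl Γ≈) (≈C-sym (⊎-assoc Γ₁ Γᵣ Δ)))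
    (λ {Δ′} {_} {m′} {e′} d′ → ⊢-idx (right-app m₁ k m′) (right-es e₁ l e′)
       (⊢-≈C (≈C-sym (⊎-assoc Γ₁ Γᵣ Δ′)) (app d₁ (rb d′))))
decompose (esL V s) (ES {Π = Π} {m′ = m₂} {e′ = e₂} d₁ d₂) with decompose V d₁
... | decomposition Ω (M ∷ Δ) (R ∷ Γᵣ) B m₀ e₀ k l d₀ refl refl (N≈ ∷ Γ≈) rb =
  decomposition (M ∷ Ω) Δ (Γᵣ ⊎ Π) B m₀ e₀ (k + m₂) (l + e₂) d₀
    (left-es k m₀ m₂) (left-es l e₀ e₂)
    (≈C-trans (⊎-cong Γ≈ ≈C-refl) (xy∙z≈xz∙y Γᵣ Δ Π))
    (λ {Δ′} {_} {m′} {e′} d′ → ⊢-idx (left-es k m′ m₂) (left-es l e′ e₂)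
       (⊢-≈C (xy∙z≈xz∙y Γᵣ Δ′ Π) (ES (rb {Δ′ = M ∷ Δ′} d′) (conv d₂ ≈C-refl (mul-cong N≈)))))
decompose (esR s V) (ES {Γ = Γ₁} {m = m₁} {e = e₁} d₁ d₂) with decompose V d₂
... | decomposition Ω Δ Γᵣ B m₀ e₀ k l d₀ refl refl Γ≈ rb =
  decomposition Ω Δ (Γ₁ ⊎ Γᵣ) B m₀ e₀ (m₁ + k) (e₁ + l) d₀
    (right-es m₁ k m₀) (right-es e₁ l e₀)
    (≈C-trans (⊎-cong ≈C-refl Γ≈) (≈C-sym (⊎-assoc Γ₁ Γᵣ Δ)))
    (λ {Δ′} {_} {m′} {e′} d′ → ⊢-idx (right-es m₁ k m′) (right-es e₁ l e′)
       (⊢-≈C (≈C-sym (⊎-assoc Γ₁ Γᵣ Δ′)) (ES d₁ (rb d′))))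

-- For a substitution context S the type of the hole is the type of the
-- whole term, so the rebuild may change the (multi) type as well.
record SDecomposition {c n} (S : SCtx c n) (t : Tm (c ⊕ n)) (Γ : Ctx n) (M : MTy) (m e : ℕ) : Set where
  constructor sdecomposition
  field
    Ω        : Vec MTy c
    Δ Γᵣ     : Ctx n
    m₀ e₀ k l : ℕ
    hole⊢    : (Ω ++ᶜ Δ) ⊢ t ∶ mul M ⟨ m₀ , e₀ ⟩
    m-split  : m ≡ k + m₀
    e-split  : e ≡ l + e₀
    Γ-split  : Γ ≈C (Γᵣ ⊎ Δ)
    rebuild  : ∀ {Δ′ t′ M′ m′ e′} → (Ω ++ᶜ Δ′) ⊢ t′ ∶ mul M′ ⟨ m′ , e′ ⟩ →
               (Γᵣ ⊎ Δ′) ⊢ plugS S t′ ∶ mul M′ ⟨ k + m′ , l + e′ ⟩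

sdecompose : ∀ {c n} (S : SCtx c n) {t Γ M m e} → Γ ⊢ plugS S t ∶ mul M ⟨ m , e ⟩ → SDecomposition S t Γ M m e
sdecompose hole {Γ = Γ} {M} {m} {e} d =
  sdecomposition [] Γ 𝟘 m e 0 0 d refl refl (≈C-sym (𝟘⊎ Γ)) (⊢-≈C (≈C-sym (𝟘⊎ _)))
sdecompose S (conv d p (mul-cong q)) with sdecompose S d
... | sdecomposition Ω Δ Γᵣ m₀ e₀ k l d₀ m≡ e≡ Γ≈ rb =
  sdecomposition Ω Δ Γᵣ m₀ e₀ k l (conv d₀ ≈C-refl (mul-cong q)) m≡ e≡ (≈C-trans (≈C-sym p) Γ≈) rb
sdecompose (sub S s) (ES {Π = Π} {m′ = m₂} {e′ = e₂} d₁ d₂) with sdecompose S d₁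
... | sdecomposition Ω (N ∷ Δ) (R ∷ Γᵣ) m₀ e₀ k l d₀ refl refl (N≈ ∷ Γ≈) rb =
  sdecomposition (N ∷ Ω) Δ (Γᵣ ⊎ Π) m₀ e₀ (k + m₂) (l + e₂) d₀
    (left-es k m₀ m₂) (left-es l e₀ e₂)
    (≈C-trans (⊎-cong Γ≈ ≈C-refl) (xy∙z≈xz∙y Γᵣ Δ Π))
    (λ {Δ′} {_} {_} {m′} {e′} d′ → ⊢-idx (left-es k m′ m₂) (left-es l e′ e₂)
       (⊢-≈C (xy∙z≈xz∙y Γᵣ Δ′ Π) (ES (rb {Δ′ = N ∷ Δ′} d′) (conv d₂ ≈C-refl (mul-cong N≈)))))

var-inv : ∀ {n} {Γ : Ctx n} {x B m e} → Γ ⊢ var x ∶ B ⟨ m , e ⟩ →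
          m ≡ 0 × e ≡ 1 × Σ MTy (λ M → Γ ≈C single x M × B ≈T mul M)
var-inv (ax x M) = refl , refl , M , ≈C-refl , ≈T-refl (mul M)
var-inv (conv d p q) with var-inv d
... | m≡ , e≡ , M , Γ≈ , B≈ = m≡ , e≡ , M , ≈C-trans (≈C-sym p) Γ≈ , ≈T-trans (≈T-sym q) B≈

lam-inv-mul : ∀ {n} {Γ : Ctx n} {t Ls m e} → Γ ⊢ lam t ∶ mul Ls ⟨ m , e ⟩ →
              Σ (Ctx n) λ Γ′ → Σ MTy λ Ls′ → Many Γ′ t Ls′ m e × Γ′ ≈C Γ × Ls′ ≈M Ls
lam-inv-mul (many ds) = _ , _ , ds , ≈C-refl , ≈M-refl _
lam-inv-mul (conv d p (mul-cong q)) with lam-inv-mul d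
... | Γ′ , Ls′ , ds , Γ≈ , Ls≈ = Γ′ , Ls′ , ds , ≈C-trans Γ≈ p , Perm.trans Ls≈ q

lam-inv-lin : ∀ {n} {Γ : Ctx n} {t L m e} → Γ ⊢ lam t ∶ lin L ⟨ m , e ⟩ →
              Σ MTy λ N → Σ MTy λ M → Σ (Ctx n) λ Γ′ →
              (N ∷ Γ′) ⊢ t ∶ mul M ⟨ m , e ⟩ × Γ′ ≈C Γ × (N ⇒ M) ≈L L
lam-inv-lin (fun d) = _ , _ , _ , d , ≈C-refl , ≈L-refl _
lam-inv-lin (conv d p (lin-cong q)) with lam-inv-lin d
... | N , M , Γ′ , d′ , Γ≈ , L≈ = N , M , Γ′ , d′ , ≈C-trans Γ≈ p , ≈L-trans L≈ q

many-pointwise : ∀ {n} {Γ : Ctx n} {t Ls Ls′ m e} →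
                 Many Γ t Ls m e → ListPW.Pointwise _≈L_ Ls Ls′ → Many Γ t Ls′ m e
many-pointwise []       ListPW.[]       = []
many-pointwise (d ∷ ds) (p ListPW.∷ ps) = conv d ≈C-refl (lin-cong p) ∷ many-pointwise ds ps

many-perm : ∀ {n} {Γ : Ctx n} {t Ls Ls′ m e} → Many Γ t Ls m e → Ls ≈M Ls′ →
            Σ (Ctx n) λ Γ′ → Many Γ′ t Ls′ m e × Γ′ ≈C Γ
many-perm ds (Perm.refl ps) = _ , many-pointwise ds ps , ≈C-refl
many-perm (d ∷ ds) (Perm.prep p q) with many-perm ds q
... | Π′ , ds′ , Π≈ = _ , conv d ≈C-refl (lin-cong p) ∷ ds′ , ⊎-cong ≈C-refl Π≈
many-perm (_∷_ {Γ = Γx} {m = mx} {e = ex} dx (_∷_ {Γ = Γy} {m = my} {e = ey} dy ds)) (Perm.swap p q r)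
  with many-perm ds r
... | Π′ , ds′ , Π≈ =
  _ , subst₂ (Many _ _ _) (exchange my mx _) (exchange ey ex _)
        (conv dy ≈C-refl (lin-cong q) ∷ (conv dx ≈C-refl (lin-cong p) ∷ ds′)) ,
  ≈C-trans (x∙yz≈y∙xz Γy Γx Π′) (⊎-cong ≈C-refl (⊎-cong ≈C-refl Π≈))
  where
  exchange : ∀ a b c → a + (b + c) ≡ b + (a + c)
  exchange = solve-∀
many-perm ds (Perm.trans p q) with many-perm ds p
... | Γ₁ , ds₁ , Γ₁≈ with many-perm ds₁ q
... | Γ₂ , ds₂ , Γ₂≈ = Γ₂ , ds₂ , ≈C-trans Γ₂≈ Γ₁≈

record ManySplit {n} (Γ : Ctx n) (t : Tm (suc n)) (O P : MTy) (m e : ℕ) : Set where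
  constructor many-split
  field
    Γ₁ Γ₂       : Ctx n
    m₁ m₂ e₁ e₂ : ℕ
    left        : Many Γ₁ t O m₁ e₁
    right       : Many Γ₂ t P m₂ e₂
    Γ-split     : Γ ≈C (Γ₁ ⊎ Γ₂)
    m-split     : m ≡ m₁ + m₂
    e-split     : e ≡ e₁ + e₂

split-many : ∀ {n} {Γ : Ctx n} {t} O {P m e} → Many Γ t (O ++ P) m e → ManySplit Γ t O P m e
split-many []      ds = many-split 𝟘 _ 0 _ 0 _ [] ds (≈C-sym (𝟘⊎ _)) refl refl
split-many (L ∷ O) (_∷_ {Γ = Γ₀} {m = m₀} {e = e₀} d ds) with split-many O ds
... | many-split Γ₁ Γ₂ m₁ m₂ e₁ e₂ ds₁ ds₂ Γ≈ refl refl =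
  many-split (Γ₀ ⊎ Γ₁) Γ₂ _ m₂ _ e₂ (d ∷ ds₁) ds₂
    (≈C-trans (⊎-cong ≈C-refl Γ≈) (≈C-sym (⊎-assoc Γ₀ Γ₁ Γ₂)))
    (right-es m₀ m₁ m₂) (right-es e₀ e₁ e₂)

split-value : ∀ {n} {Γ : Ctx n} {t} O {P N m e} → N ≈M (O ++ P) →
              Γ ⊢ lam t ∶ mul N ⟨ m , e ⟩ → ManySplit Γ t O P m e
split-value O N≈ d with lam-inv-mul d
... | Γ′ , Ls′ , ds , Γ′≈ , Ls≈ with many-perm ds (Perm.trans Ls≈ N≈)
... | Γ″ , ds′ , Γ″≈ with split-many O ds′
... | many-split Γ₁ Γ₂ m₁ m₂ e₁ e₂ ds₁ ds₂ Γ≈ m≡ e≡ =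
  many-split Γ₁ Γ₂ m₁ m₂ e₁ e₂ ds₁ ds₂ (≈C-trans (≈C-sym (≈C-trans Γ″≈ Γ′≈)) Γ≈) m≡ e≡

arrow-value : ∀ {n} {Γ : Ctx n} {t M N m e} → Γ ⊢ lam t ∶ mul ((M ⇒ N) ∷ []) ⟨ m , e ⟩ →
              (M ∷ Γ) ⊢ t ∶ mul N ⟨ m , e ⟩
arrow-value d with lam-inv-mul d
... | Γ′ , Ls′ , ds , Γ′≈ , Ls≈ with many-perm ds Ls≈
... | Γ″ , (_∷_ {Γ = Γ₀} {m = m₀} {e = e₀} d₀ []) , Γ″≈ with lam-inv-lin d₀
... | N′ , M′ , Γ‴ , body , Γ‴≈ , ⇒-cong N≈ M≈ =
  ⊢-idx (sym (+-identityʳ m₀)) (sym (+-identityʳ e₀))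
    (conv body (N≈ ∷ Γ≈) (mul-cong M≈))
  where
  Γ≈ : Γ‴ ≈C _
  Γ≈ = ≈C-trans Γ‴≈ (≈C-trans (≈C-sym (⊎𝟘 Γ₀)) (≈C-trans Γ″≈ Γ′≈))

-- In a derivation of x:N, Γ ⊢ V⟨⟨x⟩⟩ : A the
-- designated occurrence of x is typed by an axiom with some P, and
-- N ≈ O ⊎ P where O types the other occurrences.  Replacing that axiom
-- (indices (0,1)) by any derivation of Π ⊢ v : P yields a derivation
-- of x:O, Γ ⊎ Π ⊢ V⟨⟨v⟩⟩ : A, with exactly one axiom fewer.
record Occurrence {b n} (V : WCtx b (suc n)) (N : MTy) (Γ : Ctx n) (A : Ty) (m e : ℕ) : Set where
  constructor occurrence
  field
    O P     : MTy
    e₀      : ℕ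
    N-split : N ≈M (O ++ P)
    e-pred  : e ≡ suc e₀
    replace : ∀ {Π v m′ e′} → Π ⊢ v ∶ mul P ⟨ m′ , e′ ⟩ →
              (O ∷ (Γ ⊎ Π)) ⊢ plugW V (rename (wkN (suc b)) v) ∶ A ⟨ m + m′ , e₀ + e′ ⟩

linear-subst : ∀ {b n} (V : WCtx b (suc n)) {N Γ A m e} →
               (N ∷ Γ) ⊢ plugW V (var (wkN b zero)) ∶ A ⟨ m , e ⟩ → Occurrence V N Γ A m e
linear-subst {b} V d with decompose V d
... | decomposition Ω (M ∷ Δ) (R ∷ Γᵣ) B m₀ e₀ k l d₀ refl refl (N≈ ∷ Γ≈) rb with var-inv d₀
... | refl , refl , P , x≈ , B≈ with ++ᶜ-cancel Ω (ε b) (≈C-trans x≈ (≈C-reflexive (single-wkN b zero P)))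
... | Ω≈ , (M≈ ∷ Δ≈) =
  occurrence R P l (Perm.trans N≈ (MP.++⁺ˡ R M≈)) (+-comm l 1)
    (λ {Π} {_} {m′} v⊢ →
       ⊢-idx (cong (_+ m′) (sym (+-identityʳ k))) refl
         (⊢-≈C (++-identityʳ R ∷ ⊎-cong Γᵣ≈Γ ≈C-refl)
           (rb {Δ′ = [] ∷ Π} (conv (wk⊢ (suc b) v⊢) (++ᶜ-cong (≈C-sym Ω≈) ≈C-refl) (≈T-sym B≈)))))
  where
  open CommutativeMonoid multiMonoid using () renaming (identityʳ to ++-identityʳ)
  -- the designated occurrence uses no other variable
  Γᵣ≈Γ : Γᵣ ≈C _
  Γᵣ≈Γ = ≈C-trans (≈C-sym (⊎𝟘 Γᵣ)) (≈C-trans (⊎-cong ≈C-refl (≈C-sym Δ≈)) (≈C-sym Γ≈))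

-- Multiplicative root step: the application rule of the redex disappears.
root-m : ∀ {n} {Γ : Ctx n} {u s A m e} → u ↦m s → Γ ⊢ u ∶ A ⟨ m , e ⟩ →
         Σ ℕ λ m′ → m ≡ suc m′ × Γ ⊢ s ∶ A ⟨ m′ , e ⟩
root-m r (conv d p q) with root-m r d
... | m′ , m≡ , d′ = m′ , m≡ , conv d′ p q
root-m (rootM {b = c} S t s) (app {Γ = Γ₁} {Π} {N = N} {m′ = m₂} {e′ = e₂} d₁ d₂) with sdecompose S d₁
... | sdecomposition Ω Δ Γᵣ m₀ e₀ k l d₀ refl refl Γ≈ rb =
  k + (m₀ + m₂) , count k m₀ m₂ , ⊢-idx refl (sym (+-assoc l e₀ e₂)) (⊢-≈C ctx (rb redex⊢))
  where
  count : ∀ a b c → a + b + c + 1 ≡ suc (a + (b + c))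
  count = solve-∀
  redex⊢ : (Ω ++ᶜ (Π ⊎ Δ)) ⊢ es t (rename (wkN c) s) ∶ mul N ⟨ m₀ + m₂ , e₀ + e₂ ⟩
  redex⊢ = ⊢-≈C (≈C-trans (⊎-comm _ _) (ε-++ᶜ-⊎ Ω Π Δ)) (ES (arrow-value d₀) (wk⊢ c d₂))
  ctx : (Γᵣ ⊎ (Π ⊎ Δ)) ≈C (Γ₁ ⊎ Π)
  ctx = ≈C-trans (x∙yz≈y∙xz Γᵣ Π Δ) (≈C-trans (⊎-comm Π _) (⊎-cong (≈C-sym Γ≈) ≈C-refl))

-- Exponential root step: the axiom typing the substituted occurrence
-- disappears; the value's multi type is shared between that occurrence
-- and the remaining explicit substitution.
root-e : ∀ {n} {Γ : Ctx n} {u s A m e} → u ↦e s → Γ ⊢ u ∶ A ⟨ m , e ⟩ →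
         Σ ℕ λ e′ → e ≡ suc e′ × Γ ⊢ s ∶ A ⟨ m , e′ ⟩
root-e r (conv d p q) with root-e r d
... | e′ , e≡ , d′ = e′ , e≡ , conv d′ p q
root-e (rootE {b = b} {c} V S u) (ES {Γ = Γ₁} {Π₁} {M = M} {m = mᵥ} d₁ d₂) with sdecompose S d₂
... | sdecomposition Ω Δ Γᵣ m₀ e₀ k l d₀ refl refl Γ≈ rb
  with linear-subst (renW (lift (wkN c)) V) (subst (λ w → _ ⊢ w ∶ _ ⟨ _ , _ ⟩) (rename-plug-var (lift (wkN c)) V zero) (wkUnder⊢ c d₁))
... | occurrence O P eᵥ N≈ refl replace with split-value O N≈ d₀
... | many-split Θ₁ Θ₂ m₁ m₂ e₁ e₂ ds₁ ds₂ Θ≈ refl refl =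
  l + (eᵥ + e₂ + e₁) , count-e eᵥ l e₁ e₂ , ⊢-idx (count-m mᵥ k m₁ m₂) refl (⊢-≈C ctx (rb redex⊢))
  where
  count-e : ∀ a b c d → suc a + (b + (c + d)) ≡ suc (b + (a + d + c))
  count-e = solve-∀
  count-m : ∀ a b c d → b + (a + d + c) ≡ a + (b + (c + d))
  count-m = solve-∀
  ctx₁ : (((ε c ++ᶜ Γ₁) ⊎ Θ₂) ⊎ Θ₁) ≈C (Ω ++ᶜ (Γ₁ ⊎ Δ))
  ctx₁ = ≈C-trans (⊎-assoc _ Θ₂ Θ₁)
           (≈C-trans (⊎-cong ≈C-refl (≈C-trans (⊎-comm Θ₂ Θ₁) (≈C-sym Θ≈))) (ε-++ᶜ-⊎ Ω Γ₁ Δ))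
  redex⊢ : (Ω ++ᶜ (Γ₁ ⊎ Δ)) ⊢ _ ∶ mul M ⟨ mᵥ + m₂ + m₁ , eᵥ + e₂ + e₁ ⟩
  redex⊢ = ⊢-≈C ctx₁ (ES (replace (many ds₂)) (many ds₁))
  ctx : (Γᵣ ⊎ (Γ₁ ⊎ Δ)) ≈C (Γ₁ ⊎ Π₁)
  ctx = ≈C-trans (x∙yz≈y∙xz Γᵣ Γ₁ Δ) (⊎-cong ≈C-refl (≈C-sym Γ≈))

positive : ∀ k m′ → 1 ≤ k + suc m′ × k + m′ ≡ k + suc m′ ∸ 1
positive k m′ rewrite +-suc k m′ = s≤s z≤n , refl

step-m : ∀ {n} {Γ : Ctx n} {t t′ A m e} → t →m t′ → Γ ⊢ t ∶ A ⟨ m , e ⟩ →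
         1 ≤ m × Γ ⊢ t′ ∶ A ⟨ m ∸ 1 , e ⟩
step-m (stepM V r) d with decompose V d
... | decomposition Ω Δ Γᵣ B m₀ e₀ k l d₀ refl refl Γ≈ rb with root-m r d₀
... | m′ , refl , d′ with positive k m′
... | 1≤m , m∸1≡ = 1≤m , ⊢-idx m∸1≡ refl (⊢-≈C (≈C-sym Γ≈) (rb d′))

step-e : ∀ {n} {Γ : Ctx n} {t t′ A m e} → t →e t′ → Γ ⊢ t ∶ A ⟨ m , e ⟩ →
         1 ≤ e × Γ ⊢ t′ ∶ A ⟨ m , e ∸ 1 ⟩
step-e (stepE V r) d with decompose V d
... | decomposition Ω Δ Γᵣ B m₀ e₀ k l d₀ refl refl Γ≈ rb with root-e r d₀
... | e′ , refl , d′ with positive l e′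
... | 1≤e , e∸1≡ = 1≤e , ⊢-idx refl e∸1≡ (⊢-≈C (≈C-sym Γ≈) (rb d′))

proposition6 : ∀ {n : ℕ} {Γ : Ctx n} {t t′ : Tm n} {M : MTy} {m e : ℕ} →
    Γ ⊢ t ∶ mul M ⟨ m , e ⟩ →
    (t →m t′ → 1 ≤ m × Γ ⊢ t′ ∶ mul M ⟨ m ∸ 1 , e ⟩) ×
    (t →e t′ → 1 ≤ e × Γ ⊢ t′ ∶ mul M ⟨ m , e ∸ 1 ⟩)
proposition6 d = (λ step → step-m step d) , (λ step → step-e step d)
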